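{- Let $G$ be a graph and $K$ a clique of $G$ that is a block of $G$ and contains exactly one cut-vertex of $G$. Let $G_K$ be the graph obtained from $G$ by deleting all vertices of $K$ except this cut-vertex. Then $p(G)=p(G_K)$.
   Context: Graphs are finite and simple. For an acyclic digraph $D$, $P(D)$ is the graph on $V(D)$ with $uv$ an edge iff $(u,v)\in A(D)$ or $(v,u)\in A(D)$ or $u,v$ have a common out-neighbor in $D$. A phylogeny digraph for $G$ is an acyclic digraph $D$ with $G$ an induced subgraph of $P(D)$ and no arcs from $V(D)\setminus V(G)$ to $V(G)$; the phylogeny number $p(G)$ is the minimum of $|V(D)\setminus V(G)|$ over such $D$. -}

module Defs where

open import Data.Nat using (ℕ; _≤_)
open import Data.Fin using (Fin; _≟_)
open import Data.Bool using (Bool; true; false; not; _∨_)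
open import Data.Sum using (_⊎_; inj₁; inj₂)
open import Data.Product using (Σ; ∃; _×_; _,_)
open import Relation.Nullary using (¬_; does)
open import Relation.Binary.PropositionalEquality using (_≡_; _≢_)
open import Relation.Binary.Construct.Closure.Transitive using (TransClosure)
open import Relation.Binary.Construct.Closure.ReflexiveTransitive using (Star)

record Graph (V : Set) : Set where
  field
    adj    : V → V → Bool
    sym    : ∀ u v → adj u v ≡ adj v u
    irrefl : ∀ v → adj v v ≡ false
open Graph public

Digraph : Set → Set
Digraph W = W → W → Bool

Arc : ∀ {W} → Digraph W → W → W → Set
Arc D x y = D x y ≡ true

Acyclic : ∀ {W} → Digraph W → Set
Acyclic D = ∀ x → ¬ TransClosure (Arc D) x x

PEdge : ∀ {W} → Digraph W → W → W → Set
PEdge D x y = x ≢ y × (Arc D x y ⊎ Arc D y x ⊎ ∃ λ z → Arc D x z × Arc D y z)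

-- D is a phylogeny digraph for G whose vertex set is V(G) together with
-- k extra vertices (V(D) = V ⊎ Fin k, V(G) embedded via inj₁).
IsPhylogenyDigraph : ∀ {V} → Graph V → (k : ℕ) → Digraph (V ⊎ Fin k) → Set
IsPhylogenyDigraph {V} G k D =
  Acyclic D
  × (∀ (u v : V) → (adj G u v ≡ true → PEdge D (inj₁ u) (inj₁ v))
                 × (PEdge D (inj₁ u) (inj₁ v) → adj G u v ≡ true))
  × (∀ (x : Fin k) (v : V) → D (inj₂ x) (inj₁ v) ≡ false)

IsPhylogenyNumber : ∀ {V} → Graph V → ℕ → Set
IsPhylogenyNumber G p =
  (Σ (Digraph (_ ⊎ Fin p)) λ D → IsPhylogenyDigraph G p D)
  × (∀ k (D : Digraph (_ ⊎ Fin k)) → IsPhylogenyDigraph G k D → p ≤ k)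

VSet : ℕ → Set
VSet n = Fin n → Bool

module _ {n : ℕ} (G : Graph (Fin n)) where

  StepIn : VSet n → Fin n → Fin n → Set
  StepIn S u w = S u ≡ true × S w ≡ true × adj G u w ≡ true

  ConnIn : VSet n → Fin n → Fin n → Set
  ConnIn S u w = S u ≡ true × S w ≡ true × Star (StepIn S) u w

  ConnectedIn : VSet n → Set
  ConnectedIn S = (∃ λ v → S v ≡ true) × (∀ u w → S u ≡ true → S w ≡ true → ConnIn S u w)

  remove : VSet n → Fin n → VSet n
  remove S v x = S x Data.Bool.∧ not (does (x ≟ v))

  -- v is a cut-vertex of G[S]: its deletion disconnects two vertices
  -- that were connected in G[S] (i.e. increases the number of components)
  CutVertexIn : VSet n → Fin n → Set
  CutVertexIn S v = S v ≡ true × (∃ λ u → ∃ λ w → u ≢ v × w ≢ v × ConnIn S u w × ¬ ConnIn (remove S v) u w)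

  allV : VSet n
  allV _ = true

  CutVertex : Fin n → Set
  CutVertex = CutVertexIn allV

  NonseparableIn : VSet n → Set
  NonseparableIn S = ConnectedIn S × (∀ v → ¬ CutVertexIn S v)

  -- S spans a block: a maximal connected subgraph without a cut-vertex
  -- (maximal subgraphs of this kind are induced, so vertex sets suffice)
  Block : VSet n → Set
  Block S = NonseparableIn S
          × (∀ S' → (∀ v → S v ≡ true → S' v ≡ true) → (∃ λ v → S' v ≡ true × S v ≡ false)
                  → ¬ NonseparableIn S')

  Clique : VSet n → Set
  Clique S = ∀ u v → S u ≡ true → S v ≡ true → u ≢ v → adj G u v ≡ true

  Induced : (S : VSet n) → Graph (Σ (Fin n) λ v → S v ≡ true)
  Induced S = record { adj = λ u w → adj G (Data.Product.proj₁ u) (Data.Product.proj₁ w)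
                     ; sym = λ u w → sym G (Data.Product.proj₁ u) (Data.Product.proj₁ w)
                     ; irrefl = λ u → irrefl G (Data.Product.proj₁ u) }

  keepK : VSet n → Fin n → VSet n
  keepK K c v = not (K v) ∨ does (v ≟ c)

module Submission where

-- (I) Pendant clique lemma (neighboursStayInK): every neighbour of a vertex
--     v ∈ K ∖ {c} lies in K.  Otherwise, since v is no cut-vertex, a neighbour
--     y ∉ K of v reaches K again in G - v; such a return path, made simple
--     by cutting out loops, forms with K an "ear" K ∪ {y, …}, which is
--     nonseparable because every vertex reaches the clique K along the path in
--     one of its two directions.  This contradicts the maximality of the block K.
-- (II) Transfer (module Transfer): if K ∋ c is a clique whose other vertices
--     have all their neighbours in K, then G and G_K have phylogeny digraphs
--     with the same numbers k of extra vertices.  Restricting a digraph for G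
--     works because a removed vertex can only be a common prey of c; a digraph
--     for G_K is extended by arcs from c to the removed vertices and between
--     removed vertices in index order, which keeps it acyclic.
-- Since p is a minimum over k (samePhylogenyNumber), p(G) = p(G_K) follows.

open import Defs hiding (sym)
open import Data.Nat using (ℕ; zero; suc; _+_; _<_; _≤_; z≤n; s≤s; _≤?_; _<?_)
open import Data.Nat.Properties
  using (≤-refl; ≤-trans; <-trans; <-irrefl; ≤-<-trans; <⇒≤; ≤-pred; ≰⇒>; ≤-antisym;
         m≤n⇒m≤1+n; n≤1+n; ≤∧≢⇒<; m≤m+n; ≤⇒≯; m<m+n; +-suc; +-monoˡ-<; m≤n⇒m<n∨m≡n;
         m≤n⇒∃[o]m+o≡n; <-cmp; anyUpTo?)
open import Data.Nat.Tactic.RingSolver using (solve-∀)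
open import Data.Fin using (Fin; _≟_; toℕ)
open import Data.Fin.Properties using (toℕ-injective)
open import Data.Bool using (Bool; true; false; not; _∨_; _∧_)
open import Data.Bool.Properties using (not-injective; ∧-zeroʳ) renaming (_≟_ to _≟ᵇ_)
open import Data.Sum using (_⊎_; inj₁; inj₂; map₁)
open import Data.Sum.Properties using (inj₁-injective)
open import Data.Product using (Σ; ∃; _×_; _,_; proj₁; proj₂)
open import Data.Empty using (⊥-elim)
open import Relation.Nullary using (¬_; Dec; yes; no; does; _×-dec_)
open import Relation.Nullary.Decidable using (dec-true)
open import Relation.Binary.Definitions using (tri<; tri≈; tri>)
open import Relation.Binary.PropositionalEquality
open import Relation.Binary.Construct.Closure.ReflexiveTransitive using (Star; ε; _◅_; _◅◅_; reverse)
open import Relation.Binary.Construct.Closure.Transitive using (TransClosure; [_]; _∷_)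
open import Axiom.UniquenessOfIdentityProofs using (module Decidable⇒UIP)

true≢false : true ≢ false
true≢false ()

∨-introˡ : ∀ {a b} → a ≡ true → a ∨ b ≡ true
∨-introˡ refl = refl

∨-introʳ : ∀ {a b} → b ≡ true → a ∨ b ≡ true
∨-introʳ {true}  _ = refl
∨-introʳ {false} h = h

∨-elim : ∀ {a b} → a ∨ b ≡ true → a ≡ true ⊎ b ≡ true
∨-elim {true}  _ = inj₁ refl
∨-elim {false} h = inj₂ h

∧-intro : ∀ {a b} → a ≡ true → b ≡ true → a ∧ b ≡ true
∧-intro refl refl = refl

∧-elimˡ : ∀ {a b} → a ∧ b ≡ true → a ≡ true
∧-elimˡ {true} _ = refl

∧-elimʳ : ∀ {a b} → a ∧ b ≡ true → b ≡ true
∧-elimʳ {true} h = h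

witness : ∀ {P : Set} (d : Dec P) → does d ≡ true → P
witness (yes p) _ = p

module _ {n : ℕ} (G : Graph (Fin n)) where

  adj⇒≢ : ∀ {u v} → adj G u v ≡ true → u ≢ v
  adj⇒≢ {u} uv refl = true≢false (trans (sym uv) (irrefl G u))

  ∈remove : ∀ {S x y} → S y ≡ true → y ≢ x → remove G S x y ≡ true
  ∈remove {x = x} {y} Sy y≢x with y ≟ x
  ... | yes y≡x = ⊥-elim (y≢x y≡x)
  ... | no _    = ∧-intro Sy refl

  remove⇒≢ : ∀ {S x y} → remove G S x y ≡ true → y ≢ x
  remove⇒≢ {S} {x} {y} h y≡x with y ≟ x
  ... | yes _ = true≢false (sym (∧-elimʳ {S y} h))
  ... | no y≢x = y≢x y≡x

  ReachesIn : VSet n → VSet n → Fin n → Set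
  ReachesIn K X y = ∃ λ h → K h ≡ true × X h ≡ true × Star (StepIn G X) y h

  reverseWalk : ∀ {X u w} → Star (StepIn G X) u w → Star (StepIn G X) w u
  reverseWalk = reverse λ { {u} {w} (Xu , Xw , uw) → Xw , Xu , trans (Graph.sym G w u) uw }

  joinThroughClique : ∀ {K X u u'} → Clique G K → ReachesIn K X u → ReachesIn K X u'
                    → Star (StepIn G X) u u'
  joinThroughClique cl (h , Kh , Xh , uh) (h' , Kh' , Xh' , u'h') with h ≟ h'
  ... | yes refl = uh ◅◅ reverseWalk u'h'
  ... | no h≢h'  = uh ◅◅ ((Xh , Xh' , cl h h' Kh Kh' h≢h') ◅ reverseWalk u'h')

  nonseparableViaClique : ∀ {K S} → Clique G K → (∃ λ v → S v ≡ true)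
    → (∀ y → S y ≡ true → ReachesIn K S y)
    → (∀ x y → S y ≡ true → y ≢ x → ReachesIn K (remove G S x) y)
    → NonseparableIn G S
  nonseparableViaClique {S = S} cl nonempty reach reachAvoiding =
      (nonempty , λ u w Su Sw → Su , Sw , joinThroughClique cl (reach u Su) (reach w Sw))
    , λ { x (_ , u , w , u≢x , w≢x , (Su , Sw , _) , disconnected) →
          disconnected ( ∈remove {S} Su u≢x , ∈remove {S} Sw w≢x
                       , joinThroughClique cl (reachAvoiding x u Su u≢x) (reachAvoiding x w Sw w≢x)) }

module ReturnPaths {n : ℕ} (G : Graph (Fin n)) (K : VSet n) where

  record ReturnPath (v w : Fin n) : Set where
    field
      len       : ℕ
      at        : ℕ → Fin n
      starts    : at 0 ≡ w
      adjacent  : ∀ i → i < len → adj G (at i) (at (suc i)) ≡ true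
      outside   : ∀ i → i < len → K (at i) ≡ false
      endsInK   : K (at len) ≡ true
      endAvoids : at len ≢ v
  open ReturnPath public

  stay : ∀ {v w} → K w ≡ true → w ≢ v → ReturnPath v w
  stay {w = w} Kw w≢v = record
    { len = 0 ; at = λ _ → w ; starts = refl ; adjacent = λ _ () ; outside = λ _ ()
    ; endsInK = Kw ; endAvoids = w≢v }

  prepend : ∀ {v a w} → K a ≡ false → adj G a w ≡ true → ReturnPath v w → ReturnPath v a
  prepend {a = a} Ka aw P = record
    { len       = suc (len P)
    ; at        = λ { zero → a ; (suc i) → at P i }
    ; starts    = refl
    ; adjacent  = λ { zero _ → subst (λ z → adj G a z ≡ true) (sym (starts P)) aw
                    ; (suc i) (s≤s i<len) → adjacent P i i<len }
    ; outside   = λ { zero _ → Ka ; (suc i) (s≤s i<len) → outside P i i<len }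
    ; endsInK   = endsInK P
    ; endAvoids = endAvoids P }

  returnPath : ∀ {v a b} → K a ≡ false → K b ≡ true
             → Star (StepIn G (remove G (allV G) v)) a b → ReturnPath v a
  returnPath Ka Kb ε = ⊥-elim (true≢false (trans (sym Kb) Ka))
  returnPath Ka Kb (_◅_ {j = a'} (_ , a'≢v , aa') rest) with K a' in Ka'
  ... | true  = prepend Ka aa' (stay Ka' (remove⇒≢ G a'≢v))
  ... | false = prepend Ka aa' (returnPath Ka' Kb rest)

  Simple : ∀ {v w} → ReturnPath v w → Set
  Simple P = ∀ a b → a < b → b < len P → at P a ≢ at P b

  -- Cutting out the loop between positions i and j = suc (i + o) of a path
  -- with at i ≡ at j: the new path follows `at` up to i and then jumps ahead.
  module Shortcut {v w} (P : ReturnPath v w) (i o r : ℕ)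
                  (loop : at P i ≡ at P (suc (i + o))) (length : len P ≡ suc (suc (i + o)) + r) where

    skip : ℕ → ℕ
    skip k with k ≤? i
    ... | yes _ = k
    ... | no _  = k + suc o

    skip-≤ : ∀ {k} → k ≤ i → skip k ≡ k
    skip-≤ {k} k≤i with k ≤? i
    ... | yes _  = refl
    ... | no k≰i = ⊥-elim (k≰i k≤i)

    skip-> : ∀ {k} → ¬ k ≤ i → skip k ≡ k + suc o
    skip-> {k} k≰i with k ≤? i
    ... | yes k≤i = ⊥-elim (k≰i k≤i)
    ... | no _    = refl

    newLen : ℕ
    newLen = i + suc r

    newLen-shift : newLen + suc o ≡ len P
    newLen-shift = trans (shift i o r) (sym length)
      where
        shift : ∀ i o r → (i + suc r) + suc o ≡ suc (suc (i + o)) + r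
        shift = solve-∀

    loopEnd<len : suc (i + o) < len P
    loopEnd<len = subst (suc (i + o) <_) (sym length) (m≤m+n (suc (suc (i + o))) r)

    early-bound : ∀ {k} → k ≤ i → k < len P
    early-bound k≤i = <-trans (s≤s (≤-trans k≤i (m≤m+n i o))) loopEnd<len

    shifted-bound : ∀ {k} → k < newLen → k + suc o < len P
    shifted-bound k<new = subst (_ <_) newLen-shift (+-monoˡ-< (suc o) k<new)

    skip-bound : ∀ {k} → k < newLen → skip k < len P
    skip-bound {k} k<new = byCases (k ≤? i)
      where
        byCases : Dec (k ≤ i) → skip k < len P
        byCases (yes k≤i) rewrite skip-≤ k≤i = early-bound k≤i
        byCases (no k≰i)  rewrite skip-> k≰i = shifted-bound k<new

    skip-step : ∀ k → k < newLen → adj G (at P (skip k)) (at P (skip (suc k))) ≡ true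
    skip-step k k<new = byCases (suc k ≤? i) (k ≤? i)
      where
        byCases : Dec (suc k ≤ i) → Dec (k ≤ i) → adj G (at P (skip k)) (at P (skip (suc k))) ≡ true
        byCases (yes sk≤i) _ rewrite skip-≤ sk≤i | skip-≤ (<⇒≤ sk≤i) = adjacent P k (early-bound (<⇒≤ sk≤i))
        byCases (no sk≰i) (no k≰i) rewrite skip-> sk≰i | skip-> k≰i = adjacent P (k + suc o) (shifted-bound k<new)
        byCases (no sk≰i) (yes k≤i) with ≤-antisym k≤i (≤-pred (≰⇒> sk≰i))
        ... | refl rewrite skip-> sk≰i | skip-≤ k≤i =
              -- the jump: at i ≡ at j, and at j is adjacent to at (suc j)
              subst₂ (λ a b → adj G a b ≡ true) (sym loop) (cong (λ z → at P (suc z)) (sym (+-suc i o)))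
                     (adjacent P (suc (i + o)) loopEnd<len)

    newLen<len : newLen < len P
    newLen<len = subst (newLen <_) newLen-shift (m<m+n newLen (s≤s z≤n))

    lastSame : at P (skip newLen) ≡ at P (len P)
    lastSame = cong (at P) (trans (skip-> (λ h → ≤⇒≯ h (m<m+n i (s≤s z≤n)))) newLen-shift)

    shortened : ReturnPath v w
    shortened = record
      { len       = newLen
      ; at        = λ k → at P (skip k)
      ; starts    = trans (cong (at P) (skip-≤ z≤n)) (starts P)
      ; adjacent  = skip-step
      ; outside   = λ k k<new → outside P (skip k) (skip-bound k<new)
      ; endsInK   = subst (λ z → K z ≡ true) (sym lastSame) (endsInK P)
      ; endAvoids = λ e → endAvoids P (trans (sym lastSame) e) }

  repetition? : ∀ {v w} (P : ReturnPath v w) → Dec (∃ λ j → j < len P × ∃ λ i → i < j × at P i ≡ at P j)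
  repetition? P = anyUpTo? (λ j → anyUpTo? (λ i → at P i ≟ at P j) j) (len P)

  simplifyWithin : ∀ {v w} (bound : ℕ) (P : ReturnPath v w) → len P ≤ bound → Σ (ReturnPath v w) Simple
  simplifyWithin bound P len≤bound with repetition? P
  ... | no none = P , λ a b a<b b<len same → none (b , b<len , a , a<b , same)
  simplifyWithin zero P len≤0 | yes (j , j<len , _) = ⊥-elim (≤⇒≯ len≤0 (≤-<-trans z≤n j<len))
  simplifyWithin (suc bound) P len≤bound | yes (j , j<len , i , i<j , loop)
    with m≤n⇒∃[o]m+o≡n i<j | m≤n⇒∃[o]m+o≡n j<len
  ... | o , refl | r , length =
    simplifyWithin bound (Shortcut.shortened P i o r loop (sym length))
                   (≤-pred (≤-trans (Shortcut.newLen<len P i o r loop (sym length)) len≤bound))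

  simplify : ∀ {v w} → ReturnPath v w → Σ (ReturnPath v w) Simple
  simplify P = simplifyWithin (len P) P ≤-refl

module Ear {n : ℕ} (G : Graph (Fin n)) (K : VSet n) (cl : Clique G K)
           {v w : Fin n} (Kv : K v ≡ true) (wv : adj G w v ≡ true)
           (P : ReturnPaths.ReturnPath G K v w) (simple : ReturnPaths.Simple G K P) where
  open ReturnPaths G K

  onPath : VSet n
  onPath y = does (anyUpTo? (λ i → at P i ≟ y) (len P))

  S : VSet n
  S y = K y ∨ onPath y

  S-cases : ∀ {y} → S y ≡ true → K y ≡ true ⊎ ∃ λ i → i < len P × at P i ≡ y
  S-cases {y} Sy with ∨-elim {K y} Sy
  ... | inj₁ Ky     = inj₁ Ky
  ... | inj₂ onP    = inj₂ (witness (anyUpTo? (λ i → at P i ≟ y) (len P)) onP)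

  S-K : ∀ {y} → K y ≡ true → S y ≡ true
  S-K Ky = ∨-introˡ Ky

  S-at : ∀ {k} → k ≤ len P → S (at P k) ≡ true
  S-at {k} k≤len with m≤n⇒m<n∨m≡n k≤len
  ... | inj₁ k<len = ∨-introʳ (dec-true (anyUpTo? (λ i → at P i ≟ at P k) (len P)) (k , k<len , refl))
  ... | inj₂ refl  = S-K (endsInK P)

  -- distinct positions carry distinct vertices (the last one being the only one in K)
  ordered-distinct : ∀ {a b} → a < b → b ≤ len P → at P a ≢ at P b
  ordered-distinct {a} {b} a<b b≤len same with m≤n⇒m<n∨m≡n b≤len
  ... | inj₁ b<len = simple a b a<b b<len same
  ... | inj₂ refl  = true≢false (trans (sym (endsInK P)) (trans (cong K (sym same)) (outside P a a<b)))

  at-injective : ∀ {a b} → a ≤ len P → b ≤ len P → at P a ≡ at P b → a ≡ b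
  at-injective {a} {b} a≤len b≤len same with <-cmp a b
  ... | tri< a<b _ _ = ⊥-elim (ordered-distinct a<b b≤len same)
  ... | tri≈ _ a≡b _ = a≡b
  ... | tri> _ _ b<a = ⊥-elim (ordered-distinct b<a a≤len (sym same))

  v-offPath : ∀ {j} → j ≤ len P → at P j ≢ v
  v-offPath {j} j≤len with m≤n⇒m<n∨m≡n j≤len
  ... | inj₁ j<len = λ same → true≢false (trans (sym Kv) (trans (cong K (sym same)) (outside P j j<len)))
  ... | inj₂ refl  = endAvoids P

  segment : ∀ X {i j} → i ≤ j → j ≤ len P → (∀ k → i ≤ k → k ≤ j → X (at P k) ≡ true)
          → Star (StepIn G X) (at P i) (at P j)
  segment X {j = zero} z≤n _ inX = ε
  segment X {i} {suc j} i≤sj sj≤len inX with m≤n⇒m<n∨m≡n i≤sj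
  ... | inj₂ refl      = ε
  ... | inj₁ (s≤s i≤j) =
    segment X i≤j (<⇒≤ sj≤len) (λ k i≤k k≤j → inX k i≤k (m≤n⇒m≤1+n k≤j))
    ◅◅ ((inX j i≤j (n≤1+n j) , inX (suc j) i≤sj ≤-refl , adjacent P j sj≤len) ◅ ε)

  forwardReach : ∀ X {i} → i ≤ len P → (∀ k → i ≤ k → k ≤ len P → X (at P k) ≡ true)
               → ReachesIn G K X (at P i)
  forwardReach X i≤len inX = at P (len P) , endsInK P , inX (len P) i≤len ≤-refl , segment X i≤len ≤-refl inX

  backwardReach : ∀ X {i} → i ≤ len P → (∀ k → k ≤ i → X (at P k) ≡ true) → X v ≡ true
                → ReachesIn G K X (at P i)
  backwardReach X i≤len inX Xv =
    v , Kv , Xv , (reverseWalk G (segment X z≤n i≤len (λ k _ k≤i → inX k k≤i)) ◅◅ ((inX 0 z≤n , Xv , startv) ◅ ε))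
    where
      startv : adj G (at P 0) v ≡ true
      startv = subst (λ z → adj G z v ≡ true) (sym (starts P)) wv

  reachInS : ∀ y → S y ≡ true → ReachesIn G K S y
  reachInS y Sy with S-cases Sy
  ... | inj₁ Ky                = y , Ky , Sy , ε
  ... | inj₂ (i , i<len , refl) = forwardReach S (<⇒≤ i<len) (λ k _ k≤len → S-at k≤len)

  -- After deleting x, a path vertex goes forwards if x does not occur later
  -- on the path, and backwards (to v ≠ x) otherwise.
  reachAvoiding : ∀ x y → S y ≡ true → y ≢ x → ReachesIn G K (remove G S x) y
  reachAvoiding x y Sy y≢x with S-cases Sy
  ... | inj₁ Ky = y , Ky , ∈remove G {S} Sy y≢x , ε
  ... | inj₂ (i , i<len , refl) with anyUpTo? (λ j → (i ≤? j) ×-dec (at P j ≟ x)) (suc (len P))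
  ...   | no notLater =
          forwardReach (remove G S x) (<⇒≤ i<len)
            (λ k i≤k k≤len → ∈remove G {S} (S-at k≤len) (λ same → notLater (k , s≤s k≤len , i≤k , same)))
  ...   | yes (j , s≤s j≤len , i≤j , refl) =
          backwardReach (remove G S (at P j)) (<⇒≤ i<len)
            (λ k k≤i → ∈remove G {S} (S-at (≤-trans k≤i (<⇒≤ i<len)))
                         (λ same → <-irrefl (at-injective (≤-trans k≤i (<⇒≤ i<len)) j≤len same) (≤-<-trans k≤i i<j)))
            (∈remove G {S} (S-K Kv) (λ same → v-offPath j≤len (sym same)))
    where
      i<j : i < j
      i<j = ≤∧≢⇒< i≤j (λ { refl → y≢x refl })

  nonseparable : NonseparableIn G S
  nonseparable = nonseparableViaClique G cl (v , S-K Kv) reachInS reachAvoiding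

-- A clique block has no ear: a neighbour w ∉ K of v ∈ K admits no return path
-- to K avoiding v, for K together with it would be a larger nonseparable set.
noReturnPath : ∀ {n} (G : Graph (Fin n)) (K : VSet n) → Clique G K → Block G K
             → ∀ {v w} → K v ≡ true → K w ≡ false → adj G w v ≡ true → ¬ ReturnPaths.ReturnPath G K v w
noReturnPath G K cl bl {w = w} Kv Kw wv P = proj₂ bl S (λ _ → S-K) (w , S-w , Kw) nonseparable
  where
    open ReturnPaths G K
    open Ear G K cl Kv wv (proj₁ (simplify P)) (proj₂ (simplify P))
    S-w : S w ≡ true
    S-w = subst (λ z → S z ≡ true) (starts (proj₁ (simplify P))) (S-at z≤n)

-- Otherwise, as v
-- is no cut-vertex, such a neighbour y ∉ K would still reach c in G - v.
neighboursStayInK : ∀ {n} (G : Graph (Fin n)) (K : VSet n) (c : Fin n) → Clique G K → Block G K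
  → K c ≡ true → (∀ c' → K c' ≡ true → CutVertex G c' → c' ≡ c)
  → ∀ v y → K v ≡ true → v ≢ c → adj G v y ≡ true → K y ≡ true
neighboursStayInK G K c cl bl Kc onlyCut v y Kv v≢c vy with K y in Ky
... | true  = refl
... | false = ⊥-elim (v≢c (onlyCut v Kv (refl , y , c , y≢v , (λ c≡v → v≢c (sym c≡v)) , throughV , avoidingV)))
  where
    yv : adj G y v ≡ true
    yv = trans (Graph.sym G y v) vy
    y≢v : y ≢ v
    y≢v = adj⇒≢ G yv
    throughV : ConnIn G (allV G) y c
    throughV = refl , refl , (refl , refl , yv) ◅ (refl , refl , cl v c Kv Kc v≢c) ◅ ε
    avoidingV : ¬ ConnIn G (remove G (allV G) v) y c
    avoidingV (_ , _ , walk) = noReturnPath G K cl bl Kv Ky yv (ReturnPaths.returnPath G K Ky Kc walk)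

PhylogenyDigraphWith : ∀ {V} → Graph V → ℕ → Set
PhylogenyDigraphWith {V} G k = Σ (Digraph (V ⊎ Fin k)) (IsPhylogenyDigraph G k)

samePhylogenyNumber : ∀ {V W} (G : Graph V) (H : Graph W)
  → (∀ k → PhylogenyDigraphWith G k → PhylogenyDigraphWith H k)
  → (∀ k → PhylogenyDigraphWith H k → PhylogenyDigraphWith G k)
  → ∀ p → (IsPhylogenyNumber G p → IsPhylogenyNumber H p) × (IsPhylogenyNumber H p → IsPhylogenyNumber G p)
samePhylogenyNumber G H G⇒H H⇒G p = transfer G H G⇒H H⇒G , transfer H G H⇒G G⇒H
  where
    transfer : ∀ {V W} (G : Graph V) (H : Graph W)
      → (∀ k → PhylogenyDigraphWith G k → PhylogenyDigraphWith H k)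
      → (∀ k → PhylogenyDigraphWith H k → PhylogenyDigraphWith G k)
      → IsPhylogenyNumber G p → IsPhylogenyNumber H p
    transfer G H G⇒H H⇒G (optimal , minimal) = G⇒H p optimal , λ k D isD → lowerBound k (H⇒G k (D , isD))
      where
        lowerBound : ∀ k → PhylogenyDigraphWith G k → p ≤ k
        lowerBound k (D , isD) = minimal k D isD

Related : ∀ {W} → Digraph W → W → W → Set
Related D x y = Arc D x y ⊎ Arc D y x ⊎ ∃ λ z → Arc D x z × Arc D y z

Agrees : ∀ {V W : Set} → Graph V → Digraph W → (V → W) → V → V → Set
Agrees G D f u v = (adj G u v ≡ true → PEdge D (f u) (f v)) × (PEdge D (f u) (f v) → adj G u v ≡ true)

mapWalk : ∀ {W W' : Set} {R : W' → W' → Set} {R' : W → W → Set} (f : W' → W)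
        → (∀ {x y} → R x y → R' (f x) (f y)) → ∀ {x y} → TransClosure R x y → TransClosure R' (f x) (f y)
mapWalk f g [ r ]      = [ g r ]
mapWalk f g (r ∷ rest) = g r ∷ mapWalk f g rest

mapPEdge : ∀ {W W' : Set} {D : Digraph W} {D' : Digraph W'} (f : W' → W) → (∀ {x y} → f x ≡ f y → x ≡ y)
         → (∀ {x y} → Arc D' x y → Arc D (f x) (f y)) → ∀ {x y} → PEdge D' x y → PEdge D (f x) (f y)
mapPEdge f f-inj g (x≢y , inj₁ xy)                 = (λ e → x≢y (f-inj e)) , inj₁ (g xy)
mapPEdge f f-inj g (x≢y , inj₂ (inj₁ yx))          = (λ e → x≢y (f-inj e)) , inj₂ (inj₁ (g yx))
mapPEdge f f-inj g (x≢y , inj₂ (inj₂ (z , xz , yz))) = (λ e → x≢y (f-inj e)) , inj₂ (inj₂ (f z , g xz , g yz))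

PEdge-sym : ∀ {W} {D : Digraph W} {x y} → PEdge D x y → PEdge D y x
PEdge-sym (x≢y , inj₁ xy)                 = (λ e → x≢y (sym e)) , inj₂ (inj₁ xy)
PEdge-sym (x≢y , inj₂ (inj₁ yx))          = (λ e → x≢y (sym e)) , inj₁ yx
PEdge-sym (x≢y , inj₂ (inj₂ (z , xz , yz))) = (λ e → x≢y (sym e)) , inj₂ (inj₂ (z , yz , xz))

Agrees-sym : ∀ {V W : Set} {G : Graph V} {D : Digraph W} {f : V → W} {u v} → Agrees G D f v u → Agrees G D f u v
Agrees-sym {G = G} {D} {u = u} {v} (toP , fromP) =
  (λ uv → PEdge-sym {D = D} (toP (trans (Graph.sym G v u) uv))) ,
  (λ pe → trans (Graph.sym G u v) (fromP (PEdge-sym {D = D} pe)))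

module Transfer {n : ℕ} (G : Graph (Fin n)) (K : VSet n) (c : Fin n) (cl : Clique G K) (Kc : K c ≡ true)
  (closed : ∀ v y → K v ≡ true → v ≢ c → adj G v y ≡ true → K y ≡ true) where

  keep : VSet n
  keep = keepK G K c

  Kept : Set
  Kept = Σ (Fin n) λ v → keep v ≡ true

  GK : Graph Kept
  GK = Induced G keep

  keep-c : keep c ≡ true
  keep-c = ∨-introʳ (dec-true (c ≟ c) refl)

  removed⇒ : ∀ {a} → keep a ≡ false → K a ≡ true × a ≢ c
  removed⇒ {a} h with K a | a ≟ c
  ... | true  | no a≢c = refl , a≢c
  ... | true  | yes _  = ⊥-elim (true≢false h)
  ... | false | _      = ⊥-elim (true≢false h)

  kept∧K⇒c : ∀ {a} → K a ≡ true → keep a ≡ true → a ≡ c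
  kept∧K⇒c {a} Ka h with K a | a ≟ c
  ... | _     | yes a≡c = a≡c
  ... | true  | no _    = ⊥-elim (true≢false (sym h))
  ... | false | no _    = ⊥-elim (true≢false (sym Ka))

  keptNeighbour : ∀ {z u} → keep z ≡ false → keep u ≡ true → adj G z u ≡ true → u ≡ c
  keptNeighbour {z} {u} zR uK zu = kept∧K⇒c (closed z u (proj₁ (removed⇒ zR)) (proj₂ (removed⇒ zR)) zu) uK

  Kept-≡ : ∀ {a b : Kept} → proj₁ a ≡ proj₁ b → a ≡ b
  Kept-≡ {a , p} {.a , q} refl = cong (a ,_) (Decidable⇒UIP.≡-irrelevant _≟ᵇ_ p q)

  embed : ∀ {k} → Kept ⊎ Fin k → Fin n ⊎ Fin k
  embed = map₁ proj₁

  embed-injective : ∀ {k} {x y : Kept ⊎ Fin k} → embed x ≡ embed y → x ≡ y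
  embed-injective {x = inj₁ _} {inj₁ _} e = cong inj₁ (Kept-≡ (inj₁-injective e))
  embed-injective {x = inj₂ _} {inj₂ _} refl = refl

  ≢-keep : ∀ {a b} → keep a ≡ true → keep b ≡ false → a ≢ b
  ≢-keep aK bR refl = true≢false (trans (sym aK) bR)

  -- Restricting a phylogeny digraph for G to the kept vertices gives one for
  -- G_K: a removed common prey of two kept vertices would force both to be c.
  module Restriction (k : ℕ) (D : Digraph (Fin n ⊎ Fin k)) (isD : IsPhylogenyDigraph G k D) where

    D' : Digraph (Kept ⊎ Fin k)
    D' x y = D (embed x) (embed y)

    agreesD : ∀ u v → Agrees G D inj₁ u v
    agreesD = proj₁ (proj₂ isD)

    arc⇒adj : ∀ {u z} → keep u ≡ true → keep z ≡ false → Arc D (inj₁ u) (inj₁ z) → adj G z u ≡ true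
    arc⇒adj {u} {z} uK zR uz =
      trans (Graph.sym G z u) (proj₂ (agreesD u z) ((λ e → ≢-keep uK zR (inj₁-injective e)) , inj₁ uz))

    preyKept : ∀ {u v z} → keep u ≡ true → keep v ≡ true → u ≢ v
             → Arc D (inj₁ u) (inj₁ z) → Arc D (inj₁ v) (inj₁ z) → keep z ≡ true
    preyKept {u} {v} {z} uK vK u≢v uz vz with keep z in zK
    ... | true  = refl
    ... | false = ⊥-elim (u≢v (trans (keptNeighbour zK uK (arc⇒adj uK zK uz))
                                     (sym (keptNeighbour zK vK (arc⇒adj vK zK vz)))))

    restrictRelated : ∀ (a b : Kept) → proj₁ a ≢ proj₁ b
      → Related D (inj₁ (proj₁ a)) (inj₁ (proj₁ b)) → Related D' (inj₁ a) (inj₁ b)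
    restrictRelated a b a≢b (inj₁ ab)                        = inj₁ ab
    restrictRelated a b a≢b (inj₂ (inj₁ ba))                 = inj₂ (inj₁ ba)
    restrictRelated a b a≢b (inj₂ (inj₂ (inj₂ x , ax , bx))) = inj₂ (inj₂ (inj₂ x , ax , bx))
    restrictRelated a b a≢b (inj₂ (inj₂ (inj₁ z , az , bz))) =
      inj₂ (inj₂ (inj₁ (z , preyKept (proj₂ a) (proj₂ b) a≢b az bz) , az , bz))

    restrictedAgrees : ∀ a b → Agrees GK D' inj₁ a b
    restrictedAgrees a b =
        (λ ab → let (a≢b , rel) = proj₁ (agreesD (proj₁ a) (proj₁ b)) ab
                in (λ e → a≢b (cong embed e)) , restrictRelated a b (λ e → a≢b (cong inj₁ e)) rel)
      , (λ pe → proj₂ (agreesD (proj₁ a) (proj₁ b)) (mapPEdge {D = D} {D' = D'} embed embed-injective (λ xy → xy) pe))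

    restricted : PhylogenyDigraphWith GK k
    restricted = D' , (λ x cycle → proj₁ isD (embed x) (mapWalk {R = Arc D'} embed (λ xy → xy) cycle))
                    , restrictedAgrees
                    , (λ x a → proj₂ (proj₂ isD) x (proj₁ a))

  -- Extending a phylogeny digraph for G_K to G: the removed vertices become a
  -- transitive tournament below c (arcs c → r, and r → r' for removed r, r'
  -- in index order); every removed vertex is thus adjacent in P(D) to all of K.
  module Extension (k : ℕ) (D' : Digraph (Kept ⊎ Fin k)) (isD' : IsPhylogenyDigraph GK k D') where

    agreesD' : ∀ a b → Agrees GK D' inj₁ a b
    agreesD' = proj₁ (proj₂ isD')

    X : Set
    X = Fin n ⊎ Fin k

    keptOr-c : ∀ a b → keep a ≡ b → Kept
    keptOr-c a true  aK = a , aK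
    keptOr-c a false _  = c , keep-c

    toKept : Fin n → Kept
    toKept a = keptOr-c a (keep a) refl

    toKept-kept : ∀ {a} (aK : keep a ≡ true) → toKept a ≡ (a , aK)
    toKept-kept {a} aK = Kept-≡ (same (keep a) refl)
      where
        same : ∀ b (e : keep a ≡ b) → proj₁ (keptOr-c a b e) ≡ a
        same true  _ = refl
        same false e = ⊥-elim (true≢false (trans (sym aK) e))

    kept : X → Bool
    kept (inj₁ a) = keep a
    kept (inj₂ _) = true

    -- projection onto the vertices of the given digraph (used at kept vertices only)
    down : X → Kept ⊎ Fin k
    down = map₁ toKept

    down-embed : ∀ y → down (embed y) ≡ y
    down-embed (inj₁ (a , aK)) = cong inj₁ (toKept-kept aK)
    down-embed (inj₂ _)        = refl

    kept-embed : ∀ y → kept (embed y) ≡ true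
    kept-embed (inj₁ (_ , aK)) = aK
    kept-embed (inj₂ _)        = refl

    removedOf : ∀ {z} → kept z ≡ false → ∃ λ r → z ≡ inj₁ r × keep r ≡ false
    removedOf {inj₁ r} rR = r , refl , rR

    cliqueArc : Fin n → Fin n → Bool
    cliqueArc a b = not (keep b) ∧ (does (a ≟ c) ∨ (not (keep a) ∧ does (toℕ a <? toℕ b)))

    cliqueArc-view : ∀ {a b} → cliqueArc a b ≡ true
                   → keep b ≡ false × (a ≡ c ⊎ keep a ≡ false × toℕ a < toℕ b)
    cliqueArc-view {a} {b} h with ∨-elim {does (a ≟ c)} (∧-elimʳ {not (keep b)} h)
    ... | inj₁ fromC  = not-injective (∧-elimˡ h) , inj₁ (witness (a ≟ c) fromC)
    ... | inj₂ upward = not-injective (∧-elimˡ h)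
                      , inj₂ (not-injective (∧-elimˡ upward) , witness (toℕ a <? toℕ b) (∧-elimʳ {not (keep a)} upward))

    cliqueArc-from-c : ∀ {b} → keep b ≡ false → cliqueArc c b ≡ true
    cliqueArc-from-c bR = ∧-intro (cong not bR) (∨-introˡ (dec-true (c ≟ c) refl))

    cliqueArc-upward : ∀ {a b} → keep a ≡ false → keep b ≡ false → toℕ a < toℕ b → cliqueArc a b ≡ true
    cliqueArc-upward {a} {b} aR bR a<b =
      ∧-intro (cong not bR) (∨-introʳ {does (a ≟ c)} (∧-intro (cong not aR) (dec-true (toℕ a <? toℕ b) a<b)))

    cliqueArcX : X → X → Bool
    cliqueArcX (inj₁ a) (inj₁ b) = cliqueArc a b
    cliqueArcX _        _        = false

    cliqueArcX⇒removed : ∀ x y → cliqueArcX x y ≡ true → kept y ≡ false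
    cliqueArcX⇒removed (inj₁ a) (inj₁ b) h = proj₁ (cliqueArc-view h)

    D : Digraph X
    D x y = cliqueArcX x y ∨ (kept x ∧ (kept y ∧ D' (down x) (down y)))

    arc-view : ∀ {x y} → Arc D x y → cliqueArcX x y ≡ true ⊎ (kept x ≡ true × kept y ≡ true × Arc D' (down x) (down y))
    arc-view {x} {y} h with ∨-elim {cliqueArcX x y} h
    ... | inj₁ clique = inj₁ clique
    ... | inj₂ lifted = inj₂ ( ∧-elimˡ lifted , ∧-elimˡ (∧-elimʳ {kept x} lifted)
                             , ∧-elimʳ {kept y} (∧-elimʳ {kept x} lifted))

    cliqueArc⇒arc : ∀ {a b} → cliqueArc a b ≡ true → Arc D (inj₁ a) (inj₁ b)
    cliqueArc⇒arc = ∨-introˡ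

    liftArc : ∀ {x y} → Arc D' x y → Arc D (embed x) (embed y)
    liftArc {x} {y} xy = ∨-introʳ {cliqueArcX (embed x) (embed y)} (∧-intro (kept-embed x) (∧-intro (kept-embed y)
      (subst₂ (λ p q → D' p q ≡ true) (sym (down-embed x)) (sym (down-embed y)) xy)))

    lowerArc : ∀ {x y} → Arc D x y → kept y ≡ true → Arc D' (down x) (down y)
    lowerArc {x} {y} xy yK with arc-view {x} {y} xy
    ... | inj₁ clique          = ⊥-elim (true≢false (trans (sym yK) (cliqueArcX⇒removed x y clique)))
    ... | inj₂ (_ , _ , arc') = arc'

    lowerArcFrom : ∀ x z → Arc D (embed x) z → kept z ≡ true → Arc D' x (down z)
    lowerArcFrom x z xz zK = subst (λ p → D' p (down z) ≡ true) (down-embed x) (lowerArc {embed x} {z} xz zK)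

    lowerArcBetween : ∀ x y → Arc D (embed x) (embed y) → Arc D' x y
    lowerArcBetween x y xy = subst (λ q → D' x q ≡ true) (down-embed y) (lowerArcFrom x (embed y) xy (kept-embed y))

    fromRemoved : ∀ {r y} → keep r ≡ false → Arc D (inj₁ r) y → ∃ λ r' → y ≡ inj₁ r' × keep r' ≡ false × toℕ r < toℕ r'
    fromRemoved {r} {y} rR ry with arc-view {inj₁ r} {y} ry
    ... | inj₂ (rK , _ , _) = ⊥-elim (true≢false (trans (sym rK) rR))
    fromRemoved {r} {inj₂ _} rR ry | inj₁ ()
    fromRemoved {r} {inj₁ b} rR ry | inj₁ clique with cliqueArc-view {r} clique
    ... | _  , inj₁ refl       = ⊥-elim (true≢false (trans (sym keep-c) rR))
    ... | bR , inj₂ (_ , r<b) = b , refl , bR , r<b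

    walkFromRemoved : ∀ {r y} → keep r ≡ false → TransClosure (Arc D) (inj₁ r) y
                    → ∃ λ r' → y ≡ inj₁ r' × keep r' ≡ false × toℕ r < toℕ r'
    walkFromRemoved rR [ ry ] = fromRemoved rR ry
    walkFromRemoved rR (_∷_ {y = z} ry rest) with fromRemoved {y = z} rR ry
    ... | _ , refl , r'R , r<r' with walkFromRemoved r'R rest
    ...   | r'' , y≡r'' , r''R , r'<r'' = r'' , y≡r'' , r''R , <-trans r<r' r'<r''

    removedReach : ∀ {z y} → kept z ≡ false → TransClosure (Arc D) z y → kept y ≡ false
    removedReach {inj₁ r} rR walk with walkFromRemoved rR walk
    ... | _ , refl , r'R , _ = r'R

    keptWalk : ∀ {x y} → TransClosure (Arc D) x y → kept y ≡ true → TransClosure (Arc D') (down x) (down y)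
    keptWalk {x} {y} [ xy ] yK = [ lowerArc {x} {y} xy yK ]
    keptWalk {x} {y} (_∷_ {y = z} xz rest) yK = continue (kept z) refl
      where
        continue : ∀ b → kept z ≡ b → TransClosure (Arc D') (down x) (down y)
        continue true  zK = lowerArc {x} {z} xz zK ∷ keptWalk rest yK
        continue false zR = ⊥-elim (true≢false (trans (sym yK) (removedReach zR rest)))

    acyclic : Acyclic D
    acyclic (inj₂ e) cycle = proj₁ isD' (inj₂ e) (keptWalk cycle refl)
    acyclic (inj₁ a) cycle with keep a in aK
    ... | true  = proj₁ isD' (down (inj₁ a)) (keptWalk cycle aK)
    ... | false with walkFromRemoved aK cycle
    ...   | _ , refl , _ , a<a = <-irrefl refl a<a

    intoRemoved : ∀ {a r} → Arc D (inj₁ a) (inj₁ r) → keep r ≡ false → K a ≡ true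
    intoRemoved {a} {r} ar rR with arc-view {inj₁ a} {inj₁ r} ar
    ... | inj₂ (_ , rK , _) = ⊥-elim (true≢false (trans (sym rK) rR))
    ... | inj₁ clique with cliqueArc-view {a} clique
    ...   | _ , inj₁ refl       = Kc
    ...   | _ , inj₂ (aR , _)  = proj₁ (removed⇒ aR)

    removedPartner : ∀ {u v} → keep u ≡ false → Related D (inj₁ u) (inj₁ v) → K v ≡ true
    removedPartner {u} {v} uR (inj₁ uv) with fromRemoved {u} {inj₁ v} uR uv
    ... | _ , refl , vR , _ = proj₁ (removed⇒ vR)
    removedPartner uR (inj₂ (inj₁ vu)) = intoRemoved vu uR
    removedPartner {u} {v} uR (inj₂ (inj₂ (z , uz , vz))) with fromRemoved {u} {z} uR uz
    ... | _ , refl , zR , _ = intoRemoved vz zR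

    removedRelated : ∀ {u v} → keep u ≡ false → K v ≡ true → u ≢ v → Related D (inj₁ u) (inj₁ v)
    removedRelated {u} {v} uR Kv u≢v = orient (keep v) refl
      where
        orient : ∀ b → keep v ≡ b → Related D (inj₁ u) (inj₁ v)
        orient true vK with kept∧K⇒c Kv vK
        ... | refl = inj₂ (inj₁ (cliqueArc⇒arc (cliqueArc-from-c uR)))
        orient false vR with <-cmp (toℕ u) (toℕ v)
        ... | tri< u<v _ _ = inj₁ (cliqueArc⇒arc (cliqueArc-upward uR vR u<v))
        ... | tri≈ _ u≡v _ = ⊥-elim (u≢v (toℕ-injective u≡v))
        ... | tri> _ _ v<u = inj₂ (inj₁ (cliqueArc⇒arc (cliqueArc-upward vR uR v<u)))

    removedAgrees : ∀ {u} → keep u ≡ false → ∀ v → Agrees G D inj₁ u v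
    removedAgrees {u} uR v =
        (λ uv → (λ e → adj⇒≢ G uv (inj₁-injective e))
              , removedRelated uR (closed u v (proj₁ (removed⇒ uR)) (proj₂ (removed⇒ uR)) uv) (adj⇒≢ G uv))
      , (λ { (u≢v , rel) → cl u v (proj₁ (removed⇒ uR)) (removedPartner uR rel) (λ e → u≢v (cong inj₁ e)) })

    -- Between kept vertices, P(D) agrees with P(D'): a removed common prey
    -- of two kept vertices would force both to be c.
    lowerRelated : ∀ (a b : Kept) → proj₁ a ≢ proj₁ b
                 → Related D (inj₁ (proj₁ a)) (inj₁ (proj₁ b)) → Related D' (inj₁ a) (inj₁ b)
    lowerRelated a b a≢b (inj₁ ab)       = inj₁ (lowerArcBetween (inj₁ a) (inj₁ b) ab)
    lowerRelated a b a≢b (inj₂ (inj₁ ba)) = inj₂ (inj₁ (lowerArcBetween (inj₁ b) (inj₁ a) ba))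
    lowerRelated a b a≢b (inj₂ (inj₂ (z , az , bz))) = prey (kept z) refl
      where
        prey : ∀ β → kept z ≡ β → Related D' (inj₁ a) (inj₁ b)
        prey true zK = inj₂ (inj₂ (down z , lowerArcFrom (inj₁ a) z az zK , lowerArcFrom (inj₁ b) z bz zK))
        prey false zR with removedOf {z} zR
        ... | r , refl , rR = ⊥-elim (a≢b (trans (kept∧K⇒c (intoRemoved az rR) (proj₂ a))
                                                 (sym (kept∧K⇒c (intoRemoved bz rR) (proj₂ b)))))

    keptAgrees : ∀ (a b : Kept) → Agrees G D inj₁ (proj₁ a) (proj₁ b)
    keptAgrees a b =
        (λ ab → mapPEdge {D = D} {D' = D'} embed embed-injective (λ {x} {y} → liftArc {x} {y}) (proj₁ (agreesD' a b) ab))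
      , (λ { (a≢b , rel) → proj₂ (agreesD' a b)
                             ((λ e → a≢b (cong embed e)) , lowerRelated a b (λ e → a≢b (cong inj₁ e)) rel) })

    extendedAgrees : ∀ u v → Agrees G D inj₁ u v
    extendedAgrees u v = byKept (keep u) refl (keep v) refl
      where
        byKept : ∀ β → keep u ≡ β → ∀ γ → keep v ≡ γ → Agrees G D inj₁ u v
        byKept false uR _     _  = removedAgrees uR v
        byKept true  _  false vR = Agrees-sym {G = G} {D = D} {f = inj₁} {u} {v} (removedAgrees vR u)
        byKept true  uK true  vK = keptAgrees (u , uK) (v , vK)

    noBack : ∀ x v → D (inj₂ x) (inj₁ v) ≡ false
    noBack x v rewrite proj₂ (proj₂ isD') x (toKept v) = ∧-zeroʳ (keep v)

    extended : PhylogenyDigraphWith G k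
    extended = D , acyclic , extendedAgrees , noBack

-- The theorem.
corollary2 : ∀ (n : ℕ) (G : Graph (Fin n)) (K : VSet n) (c : Fin n)
    → Clique G K → Block G K
    → K c ≡ true → CutVertex G c
    → (∀ c' → K c' ≡ true → CutVertex G c' → c' ≡ c)
    → ∀ (p : ℕ) → (IsPhylogenyNumber G p → IsPhylogenyNumber (Induced G (keepK G K c)) p)
    × (IsPhylogenyNumber (Induced G (keepK G K c)) p → IsPhylogenyNumber G p)
corollary2 n G K c cl bl Kc _ onlyCut =
  samePhylogenyNumber G GK (λ k (D , isD) → Restriction.restricted k D isD)
                           (λ k (D' , isD') → Extension.extended k D' isD')
  where
    open Transfer G K c cl Kc (neighboursStayInK G K c cl bl Kc onlyCut)
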